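{- Let $G$ be a finite simple bipartite graph with partite sets $\mathcal{L}$ and $\mathcal{R}$, and let $p,q$ be positive integers. Then \[ \hom(K_{p,q},G)=\sum_{k=1}^{p}\sum_{\ell=1}^{q} k!\,\ell!\,S(p,k)\,S(q,\ell)\,\bigl[N_{k,\ell}(G)+N_{\ell,k}(G)\bigr]. \]
   Context: All graphs are finite, simple and undirected. A homomorphism from a graph $F$ to a graph $G$ is a map $\phi:V(F)\to V(G)$ such that $\{\phi(u),\phi(v)\}\in E(G)$ whenever $\{u,v\}\in E(F)$; $\hom(F,G)$ denotes the number of such maps. $K_{p,q}$ is the complete bipartite graph with partite sets of sizes $p$ and $q$. $S(n,k)$ is the Stirling number of the second kind, the number of partitions of $\{1,\dots,n\}$ into $k$ nonempty blocks ($S(n,k)=0$ if $k\notin\{1,\dots,n\}$). For $k,\ell\ge 1$, $N_{k,\ell}(G)$ denotes the number of bipartite cliques of $G$ whose part in $\mathcal{L}$ has size $k$ and whose part in $\mathcal{R}$ has size $\ell$, i.e. the number of pairs $(A,B)$ with $A\subseteq\mathcal{L}$, $|A|=k$, $B\subseteq\mathcal{R}$, $|B|=\ell$, such that every vertex of $A$ is adjacent in $G$ to every vertex of $B$. -}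

module Defs where

open import Data.Bool using (Bool; true; false; not; _∧_; _∨_; _xor_; if_then_else_)
open import Data.Nat using (ℕ; zero; suc; _+_; _*_; _<ᵇ_; _≡ᵇ_)
open import Data.Fin using (Fin; zero; suc; toℕ)
open import Data.Fin.Subset using (Subset; ∣_∣)
open import Data.Vec using ([]; _∷_; lookup)
open import Data.List using (List; []; _∷_; [_]; map; concatMap; length; filterᵇ; foldr; allFin; upTo; cartesianProduct)
open import Data.Product using (_×_; _,_)
open import Relation.Binary.PropositionalEquality using (_≡_; refl)

record Graph : Set where
  field
    n      : ℕ
    adj    : Fin n → Fin n → Bool
    sym    : ∀ u v → adj u v ≡ adj v u
    irrefl : ∀ v → adj v v ≡ false
open Graph public

-- A bipartition (partite sets) of G: side v = false means v ∈ 𝓛,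
-- side v = true means v ∈ 𝓡; every edge joins the two sides.
IsBipartition : (G : Graph) → (Fin (n G) → Bool) → Set
IsBipartition G side = ∀ u v → adj G u v ≡ true → side u ≡ not (side v)

all : {A : Set} → (A → Bool) → List A → Bool
all P = foldr (λ x b → P x ∧ b) true

sum : List ℕ → ℕ
sum = foldr _+_ 0

count : {A : Set} → (A → Bool) → List A → ℕ
count P xs = length (filterᵇ P xs)

allFuns : (m k : ℕ) → List (Fin m → Fin k)
allFuns zero    k = [ (λ ()) ]
allFuns (suc m) k =
  concatMap (λ f → map (λ x → cons x f) (allFin k)) (allFuns m k)
  where
  cons : Fin k → (Fin m → Fin k) → Fin (suc m) → Fin k
  cons x f zero    = x
  cons x f (suc i) = f i

isHom : (F G : Graph) → (Fin (n F) → Fin (n G)) → Bool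
isHom F G φ =
  all (λ u → all (λ v → not (adj F u v) ∨ adj G (φ u) (φ v)) (allFin (n F))) (allFin (n F))

hom : Graph → Graph → ℕ
hom F G = count (isHom F G) (allFuns (n F) (n G))

private
  xor-comm : ∀ a b → (a xor b) ≡ (b xor a)
  xor-comm false false = refl
  xor-comm false true  = refl
  xor-comm true  false = refl
  xor-comm true  true  = refl

  xor-self : ∀ a → (a xor a) ≡ false
  xor-self false = refl
  xor-self true  = refl

K : ℕ → ℕ → Graph
K p q = record
  { n      = p + q
  ; adj    = λ i j → inP i xor inP j
  ; sym    = λ i j → xor-comm (inP i) (inP j)
  ; irrefl = λ i → xor-self (inP i)
  }
  where
  inP : Fin (p + q) → Bool
  inP i = toℕ i <ᵇ p

S : ℕ → ℕ → ℕ
S zero    zero    = 1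
S zero    (suc k) = 0
S (suc m) zero    = 0
S (suc m) (suc k) = suc k * S m (suc k) + S m k

fact : ℕ → ℕ
fact zero    = 1
fact (suc m) = suc m * fact m

allSubsets : (m : ℕ) → List (Subset m)
allSubsets zero    = [ [] ]
allSubsets (suc m) = concatMap (λ s → (false ∷ s) ∷ (true ∷ s) ∷ []) (allSubsets m)

N : (G : Graph) → (Fin (n G) → Bool) → ℕ → ℕ → ℕ
N G side k ℓ = count ok (cartesianProduct (allSubsets (n G)) (allSubsets (n G)))
  where
  vs = allFin (n G)
  ok : Subset (n G) × Subset (n G) → Bool
  ok (A , B) =
       (∣ A ∣ ≡ᵇ k) ∧ (∣ B ∣ ≡ᵇ ℓ)
    ∧ all (λ v → not (lookup A v) ∨ not (side v)) vs
    ∧ all (λ v → not (lookup B v) ∨ side v) vs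
    ∧ all (λ u → all (λ v → not (lookup A u ∧ lookup B v) ∨ adj G u v) vs) vs

Σ₁ : ℕ → (ℕ → ℕ) → ℕ
Σ₁ m f = sum (map (λ i → f (suc i)) (upTo m))

-- A homomorphism K_{p,q} → G is a pair of maps f : [p] → V, g : [q] → V with f i ~ g j for all
-- i, j. For fixed f the admissible g are the maps into the common neighbourhood X of the image of
-- f, and the Stirling identity |X|^q = Σ_l l! S(q,l) C(|X|,l) counts them by the l-subsets B ⊆ X
-- they could map onto. Exchanging the sums and treating f in the same way (now with X the common
-- neighbourhood of B) gives
--   hom(K_{p,q}, G) = Σ_{k,l} k! l! S(p,k) S(q,l) · #{(A, B) : |A| = k, |B| = l, A × B ⊆ E}
-- for every graph G. If G is bipartite, a pair with A, B nonempty and A × B ⊆ E lies in 𝓛 × 𝓡 or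
-- in 𝓡 × 𝓛, and in exactly one of them, so for k, l ≥ 1 the count is N_{k,l} + N_{l,k}.

{-# OPTIONS --safe #-}
module Submission where

open import Defs hiding (sym)
import Algebra.Properties.CommutativeSemigroup as CommSemigroupProperties
open import Data.Bool using (Bool; true; false; not; _∧_; _∨_; _xor_)
open import Data.Bool.Properties
  using (∧-assoc; ∧-comm; ∧-idem; ∧-identityʳ; ∧-zeroʳ; ∨-distribˡ-∧; not-involutive)
open import Data.Fin using (Fin; zero; suc; toℕ; _↑ˡ_; _↑ʳ_)
open import Data.Fin.Subset using (Subset; ∣_∣)
open import Data.List using (List; []; _∷_; [_]; map; concatMap; allFin; upTo; _++_; cartesianProduct)
open import Data.List.Properties using (map-∘; map-++; map-tabulate; map-applyUpTo; map-upTo; upTo-∷ʳ)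
open import Data.List.Membership.Propositional using (_∈_)
open import Data.List.Membership.Propositional.Properties using (∈-allFin)
open import Data.List.Relation.Unary.Any using (here; there)
open import Data.Nat using (ℕ; zero; suc; _+_; _*_; _^_; _≤_; _<_; s≤s; _≡ᵇ_; _<ᵇ_)
open import Data.Nat.Combinatorics using (_C_; nC1≡n; nCk+nC[k+1]≡[n+1]C[k+1])
open import Data.Nat.ListAction.Properties using (sum-++)
open import Data.Nat.Properties
  using (+-identityʳ; *-identityˡ; *-zeroʳ; +-comm; *-comm; *-distribˡ-+; *-distribʳ-+; ≤-refl; m<n⇒m<1+n;
         +-commutativeSemigroup; *-commutativeSemigroup)
open import Data.Nat.Tactic.RingSolver using (solve-∀)
open import Data.Product using (_×_; _,_; proj₁; proj₂; ∃-syntax)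
open import Data.Vec using (_∷_; lookup)
open import Data.Vec.Functional using (take; drop) renaming (_∷_ to _∷ᶠ_)
open import Function using (_∘_; id)
open import Relation.Binary.Core using (_Preserves_⟶_; _Preserves₂_⟶_⟶_)
open import Relation.Binary.PropositionalEquality
  using (_≡_; _≗_; refl; sym; trans; cong; cong₂; subst; module ≡-Reasoning)

open CommSemigroupProperties +-commutativeSemigroup using () renaming (interchange to +-interchange)
open CommSemigroupProperties *-commutativeSemigroup using () renaming (x∙yz≈y∙xz to *-leftComm)

private
  variable
    I J : Set

⟦_⟧ : Bool → ℕ
⟦ false ⟧ = 0
⟦ true ⟧ = 1

⟦∧⟧ : ∀ a b → ⟦ a ∧ b ⟧ ≡ ⟦ a ⟧ * ⟦ b ⟧
⟦∧⟧ false b = refl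
⟦∧⟧ true  b = sym (+-identityʳ ⟦ b ⟧)

⟦a∧b∧c⟧≡⟦b⟧*⟦a∧c⟧ : ∀ a b c → ⟦ a ∧ b ∧ c ⟧ ≡ ⟦ b ⟧ * ⟦ a ∧ c ⟧
⟦a∧b∧c⟧≡⟦b⟧*⟦a∧c⟧ a b c =
  trans (⟦∧⟧ a (b ∧ c)) (trans (cong (⟦ a ⟧ *_) (⟦∧⟧ b c))
  (trans (*-leftComm ⟦ a ⟧ ⟦ b ⟧ ⟦ c ⟧) (cong (⟦ b ⟧ *_) (sym (⟦∧⟧ a c)))))

∑ : List I → (I → ℕ) → ℕ
∑ xs f = sum (map f xs)

-- The body of ∑[ x ∈ xs ] extends over products but not over sums.
infix 6.5 ∑
syntax ∑ xs (λ x → e) = ∑[ x ∈ xs ] e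

∑-cong : ∀ (xs : List I) {f g : I → ℕ} → (∀ x → f x ≡ g x) → ∑ xs f ≡ ∑ xs g
∑-cong []       e = refl
∑-cong (x ∷ xs) e = cong₂ _+_ (e x) (∑-cong xs e)

∑-zero : ∀ (xs : List I) → ∑[ x ∈ xs ] 0 ≡ 0
∑-zero []       = refl
∑-zero (x ∷ xs) = ∑-zero xs

∑-+ : ∀ (xs : List I) (f g : I → ℕ) → ∑[ x ∈ xs ] (f x + g x) ≡ ∑ xs f + ∑ xs g
∑-+ []       f g = refl
∑-+ (x ∷ xs) f g =
  trans (cong (f x + g x +_) (∑-+ xs f g)) (+-interchange (f x) (g x) (∑ xs f) (∑ xs g))

∑-*ˡ : ∀ (xs : List I) c (f : I → ℕ) → ∑[ x ∈ xs ] (c * f x) ≡ c * ∑ xs f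
∑-*ˡ []       c f = sym (*-zeroʳ c)
∑-*ˡ (x ∷ xs) c f = trans (cong (c * f x +_) (∑-*ˡ xs c f)) (sym (*-distribˡ-+ c (f x) (∑ xs f)))

∑-*ʳ : ∀ (xs : List I) c (f : I → ℕ) → ∑[ x ∈ xs ] (f x * c) ≡ ∑ xs f * c
∑-*ʳ xs c f = trans (∑-cong xs (λ x → *-comm (f x) c)) (trans (∑-*ˡ xs c f) (*-comm c (∑ xs f)))

∑-comm : ∀ (xs : List I) (ys : List J) (f : I → J → ℕ) →
  ∑[ x ∈ xs ] ∑[ y ∈ ys ] f x y ≡ ∑[ y ∈ ys ] ∑[ x ∈ xs ] f x y
∑-comm []       ys f = sym (∑-zero ys)
∑-comm (x ∷ xs) ys f =
  trans (cong (∑ ys (f x) +_) (∑-comm xs ys f)) (sym (∑-+ ys (f x) (λ y → ∑[ x ∈ xs ] f x y)))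

∑-comm-*ˡ : ∀ (xs : List I) (ys : List J) (c : J → ℕ) (f : I → J → ℕ) →
  ∑[ x ∈ xs ] ∑[ y ∈ ys ] c y * f x y ≡ ∑[ y ∈ ys ] c y * (∑[ x ∈ xs ] f x y)
∑-comm-*ˡ xs ys c f =
  trans (∑-comm xs ys (λ x y → c y * f x y)) (∑-cong ys (λ y → ∑-*ˡ xs (c y) (λ x → f x y)))

∑-map : ∀ (xs : List I) (g : I → J) (f : J → ℕ) → ∑ (map g xs) f ≡ ∑[ x ∈ xs ] f (g x)
∑-map xs g f = cong sum (sym (map-∘ xs))

∑-++ : ∀ (xs ys : List I) (f : I → ℕ) → ∑ (xs ++ ys) f ≡ ∑ xs f + ∑ ys f
∑-++ xs ys f = trans (cong sum (map-++ f xs ys)) (sum-++ (map f xs) (map f ys))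

∑-concatMap : ∀ (xs : List I) (g : I → List J) (f : J → ℕ) →
  ∑ (concatMap g xs) f ≡ ∑[ x ∈ xs ] ∑ (g x) f
∑-concatMap []       g f = refl
∑-concatMap (x ∷ xs) g f = trans (∑-++ (g x) _ f) (cong (∑ (g x) f +_) (∑-concatMap xs g f))

∑-cartesianProduct : ∀ (xs : List I) (ys : List J) (f : I × J → ℕ) →
  ∑ (cartesianProduct xs ys) f ≡ ∑[ x ∈ xs ] ∑[ y ∈ ys ] f (x , y)
∑-cartesianProduct []       ys f = refl
∑-cartesianProduct (x ∷ xs) ys f =
  trans (∑-++ (map (x ,_) ys) _ f) (cong₂ _+_ (∑-map ys (x ,_) f) (∑-cartesianProduct xs ys f))

count≡∑ : ∀ (P : I → Bool) xs → count P xs ≡ ∑[ x ∈ xs ] ⟦ P x ⟧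
count≡∑ P [] = refl
count≡∑ P (x ∷ xs) with P x
... | true  = cong suc (count≡∑ P xs)
... | false = count≡∑ P xs

∑-upTo-suc : ∀ m (f : ℕ → ℕ) → ∑[ i ∈ upTo (suc m) ] f i ≡ f 0 + ∑[ i ∈ upTo m ] f (suc i)
∑-upTo-suc m f = cong (λ is → f 0 + sum is) (trans (map-applyUpTo suc f m) (sym (map-upTo (f ∘ suc) m)))

∑-upTo-∷ʳ : ∀ m (f : ℕ → ℕ) → ∑[ i ∈ upTo (suc m) ] f i ≡ ∑[ i ∈ upTo m ] f i + f m
∑-upTo-∷ʳ m f = begin
  ∑ (upTo (suc m)) f          ≡⟨ cong (λ is → ∑ is f) (upTo-∷ʳ m) ⟨
  ∑ (upTo m ++ [ m ]) f       ≡⟨ ∑-++ (upTo m) [ m ] f ⟩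
  ∑ (upTo m) f + (f m + 0)    ≡⟨ cong (∑ (upTo m) f +_) (+-identityʳ (f m)) ⟩
  ∑ (upTo m) f + f m          ∎
  where open ≡-Reasoning

allFin-suc : ∀ m → allFin (suc m) ≡ zero ∷ map suc (allFin m)
allFin-suc m = cong (zero ∷_) (sym (map-tabulate id suc))

∑-allFin-suc : ∀ m (f : Fin (suc m) → ℕ) → ∑ (allFin (suc m)) f ≡ f zero + ∑ (allFin m) (f ∘ suc)
∑-allFin-suc m f = trans (cong (λ is → ∑ is f) (allFin-suc m)) (cong (f zero +_) (∑-map (allFin m) suc f))

all-cong : ∀ (xs : List I) {P Q : I → Bool} → (∀ x → P x ≡ Q x) → all P xs ≡ all Q xs
all-cong []       e = refl
all-cong (x ∷ xs) e = cong₂ _∧_ (e x) (all-cong xs e)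

all-map : ∀ (xs : List I) (g : I → J) (P : J → Bool) → all P (map g xs) ≡ all (P ∘ g) xs
all-map []       g P = refl
all-map (x ∷ xs) g P = cong (P (g x) ∧_) (all-map xs g P)

all-allFin-suc : ∀ m (P : Fin (suc m) → Bool) →
  all P (allFin (suc m)) ≡ P zero ∧ all (P ∘ suc) (allFin m)
all-allFin-suc m P = trans (cong (all P) (allFin-suc m)) (cong (P zero ∧_) (all-map (allFin m) suc P))

all-allFin-+ : ∀ p q (P : Fin (p + q) → Bool) →
  all P (allFin (p + q)) ≡ all (P ∘ (_↑ˡ q)) (allFin p) ∧ all (P ∘ (p ↑ʳ_)) (allFin q)
all-allFin-+ zero    q P = refl
all-allFin-+ (suc p) q P = begin
  all P (allFin (suc (p + q)))
    ≡⟨ all-allFin-suc (p + q) P ⟩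
  P zero ∧ all (P ∘ suc) (allFin (p + q))
    ≡⟨ cong (P zero ∧_) (all-allFin-+ p q (P ∘ suc)) ⟩
  P zero ∧ all (P ∘ suc ∘ (_↑ˡ q)) (allFin p) ∧ all (P ∘ (suc p ↑ʳ_)) (allFin q)
    ≡⟨ ∧-assoc (P zero) _ _ ⟨
  (P zero ∧ all (P ∘ suc ∘ (_↑ˡ q)) (allFin p)) ∧ all (P ∘ (suc p ↑ʳ_)) (allFin q)
    ≡⟨ cong (_∧ all (P ∘ (suc p ↑ʳ_)) (allFin q)) (all-allFin-suc p (P ∘ (_↑ˡ q))) ⟨
  all (P ∘ (_↑ˡ q)) (allFin (suc p)) ∧ all (P ∘ (suc p ↑ʳ_)) (allFin q)
    ∎
  where open ≡-Reasoning

∧-true : ∀ {a b} → (a ∧ b) ≡ true → (a ≡ true) × (b ≡ true)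
∧-true {true} {true} refl = refl , refl

all⁺ : ∀ (xs : List I) {P : I → Bool} → (∀ {x} → x ∈ xs → P x ≡ true) → all P xs ≡ true
all⁺ []       h = refl
all⁺ (x ∷ xs) h = cong₂ _∧_ (h (here refl)) (all⁺ xs (h ∘ there))

all⁻ : ∀ {xs : List I} {P : I → Bool} {x} → all P xs ≡ true → x ∈ xs → P x ≡ true
all⁻ h (here refl)  = proj₁ (∧-true h)
all⁻ h (there x∈xs) = all⁻ (proj₂ (∧-true h)) x∈xs

all-∧ : ∀ (xs : List I) (P Q : I → Bool) → all (λ x → P x ∧ Q x) xs ≡ all P xs ∧ all Q xs
all-∧ []       P Q = refl
all-∧ (x ∷ xs) P Q with P x | Q x
... | false | _     = refl
... | true  | true  = all-∧ xs P Q
... | true  | false = sym (∧-zeroʳ (all P xs))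

all-comm : ∀ (xs : List I) (ys : List J) (R : I → J → Bool) →
  all (λ x → all (λ y → R x y) ys) xs ≡ all (λ y → all (λ x → R x y) xs) ys
all-comm []       ys R = sym (all⁺ ys (λ _ → refl))
all-comm (x ∷ xs) ys R =
  trans (cong (all (R x) ys ∧_) (all-comm xs ys R)) (sym (all-∧ ys (R x) (λ y → all (λ x → R x y) xs)))

∨-all : ∀ (xs : List I) b (P : I → Bool) → b ∨ all P xs ≡ all (λ x → b ∨ P x) xs
∨-all []       true  P = refl
∨-all []       false P = refl
∨-all (x ∷ xs) b     P = trans (∨-distribˡ-∧ b (P x) (all P xs)) (cong ((b ∨ P x) ∧_) (∨-all xs b P))

-- Stirling numbers and binomial coefficients

[l+1]*xC[l+1]+l*xCl≡x*xCl : ∀ x l → suc l * (x C suc l) + l * (x C l) ≡ x * (x C l)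
[l+1]*xC[l+1]+l*xCl≡x*xCl zero    zero    = refl
[l+1]*xC[l+1]+l*xCl≡x*xCl zero    (suc l) = cong₂ _+_ (*-zeroʳ (suc (suc l))) (*-zeroʳ (suc l))
[l+1]*xC[l+1]+l*xCl≡x*xCl (suc x) zero    = trans (cong (λ c → 1 * c + 0) (nC1≡n (suc x))) (unit (suc x))
  where
  unit : ∀ y → 1 * y + 0 ≡ y * 1
  unit = solve-∀
[l+1]*xC[l+1]+l*xCl≡x*xCl (suc x) (suc l) = begin
  suc (suc l) * (suc x C suc (suc l)) + suc l * (suc x C suc l)
    ≡⟨ cong₂ (λ u v → suc (suc l) * u + suc l * v)
             (nCk+nC[k+1]≡[n+1]C[k+1] x (suc l)) (nCk+nC[k+1]≡[n+1]C[k+1] x l) ⟨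
  suc (suc l) * (b + c) + suc l * (a + b)
    ≡⟨ regroup l a b c ⟩
  (suc (suc l) * c + suc l * b) + (suc l * b + l * a) + (a + b)
    ≡⟨ cong₂ (λ u v → u + v + (a + b)) ([l+1]*xC[l+1]+l*xCl≡x*xCl x (suc l)) ([l+1]*xC[l+1]+l*xCl≡x*xCl x l) ⟩
  x * b + x * a + (a + b)
    ≡⟨ collect x a b ⟩
  suc x * (a + b)
    ≡⟨ cong (suc x *_) (nCk+nC[k+1]≡[n+1]C[k+1] x l) ⟩
  suc x * (suc x C suc l)
    ∎
  where
  open ≡-Reasoning
  a b c : ℕ
  a = x C l
  b = x C suc l
  c = x C suc (suc l)
  regroup : ∀ l a b c → suc (suc l) * (b + c) + suc l * (a + b) ≡
                        (suc (suc l) * c + suc l * b) + (suc l * b + l * a) + (a + b)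
  regroup = solve-∀
  collect : ∀ x a b → x * b + x * a + (a + b) ≡ suc x * (a + b)
  collect = solve-∀

falling : ℕ → ℕ → ℕ
falling x l = fact l * (x C l)

falling-suc : ∀ x l → x * falling x l ≡ falling x (suc l) + l * falling x l
falling-suc x l = begin
  x * (fact l * (x C l))                              ≡⟨ *-leftComm x (fact l) (x C l) ⟩
  fact l * (x * (x C l))                              ≡⟨ cong (fact l *_) ([l+1]*xC[l+1]+l*xCl≡x*xCl x l) ⟨
  fact l * (suc l * (x C suc l) + l * (x C l))        ≡⟨ distribute (fact l) l (x C suc l) (x C l) ⟩
  suc l * fact l * (x C suc l) + l * (fact l * (x C l)) ∎
  where
  open ≡-Reasoning
  distribute : ∀ f l c d → f * (suc l * c + l * d) ≡ suc l * f * c + l * (f * d)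
  distribute = solve-∀

q<l⇒S≡0 : ∀ {q l} → q < l → S q l ≡ 0
q<l⇒S≡0 {zero}  {suc l} _         = refl
q<l⇒S≡0 {suc q} {suc l} (s≤s q<l)
  rewrite q<l⇒S≡0 (m<n⇒m<1+n q<l) | q<l⇒S≡0 q<l = trans (+-identityʳ _) (*-zeroʳ (suc l))

∑-shift-l*S : ∀ q (g : ℕ → ℕ) →
  ∑[ l ∈ upTo (suc q) ] l * S q l * g l ≡ ∑[ l ∈ upTo (suc q) ] suc l * S q (suc l) * g (suc l)
∑-shift-l*S q g = begin
  ∑[ l ∈ upTo (suc q) ] l * S q l * g l           ≡⟨ ∑-upTo-suc q (λ l → l * S q l * g l) ⟩
  ∑[ l ∈ upTo q ] h l                             ≡⟨ +-identityʳ _ ⟨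
  ∑[ l ∈ upTo q ] h l + 0                         ≡⟨ cong (∑[ l ∈ upTo q ] h l +_) h-top ⟨
  ∑[ l ∈ upTo q ] h l + h q                       ≡⟨ ∑-upTo-∷ʳ q h ⟨
  ∑[ l ∈ upTo (suc q) ] h l                       ∎
  where
  open ≡-Reasoning
  h : ℕ → ℕ
  h l = suc l * S q (suc l) * g (suc l)
  h-top : h q ≡ 0
  h-top = trans (cong (λ s → suc q * s * g (suc q)) (q<l⇒S≡0 {q} ≤-refl))
                (cong (_* g (suc q)) (*-zeroʳ (suc q)))

^≡∑-S*falling : ∀ x q → x ^ q ≡ ∑[ l ∈ upTo (suc q) ] S q l * falling x l
^≡∑-S*falling x zero    = refl
^≡∑-S*falling x (suc q) = begin
  x * x ^ q
    ≡⟨ cong (x *_) (^≡∑-S*falling x q) ⟩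
  x * (∑[ l ∈ upTo (suc q) ] S q l * F l)
    ≡⟨ ∑-*ˡ (upTo (suc q)) x (λ l → S q l * F l) ⟨
  ∑[ l ∈ upTo (suc q) ] x * (S q l * F l)
    ≡⟨ ∑-cong (upTo (suc q)) multiply ⟩
  ∑[ l ∈ upTo (suc q) ] (l * S q l * F l + S q l * F (suc l))
    ≡⟨ ∑-+ (upTo (suc q)) (λ l → l * S q l * F l) (λ l → S q l * F (suc l)) ⟩
  ∑[ l ∈ upTo (suc q) ] l * S q l * F l + ∑[ l ∈ upTo (suc q) ] S q l * F (suc l)
    ≡⟨ cong (_+ ∑[ l ∈ upTo (suc q) ] S q l * F (suc l)) (∑-shift-l*S q F) ⟩
  ∑[ l ∈ upTo (suc q) ] suc l * S q (suc l) * F (suc l) + ∑[ l ∈ upTo (suc q) ] S q l * F (suc l)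
    ≡⟨ ∑-+ (upTo (suc q)) (λ l → suc l * S q (suc l) * F (suc l)) (λ l → S q l * F (suc l)) ⟨
  ∑[ l ∈ upTo (suc q) ] (suc l * S q (suc l) * F (suc l) + S q l * F (suc l))
    ≡⟨ ∑-cong (upTo (suc q)) (λ l → *-distribʳ-+ (F (suc l)) (suc l * S q (suc l)) (S q l)) ⟨
  ∑[ l ∈ upTo (suc q) ] S (suc q) (suc l) * F (suc l)
    ≡⟨ ∑-upTo-suc (suc q) (λ l → S (suc q) l * F l) ⟨
  ∑[ l ∈ upTo (suc (suc q)) ] S (suc q) l * F l
    ∎
  where
  open ≡-Reasoning
  F : ℕ → ℕ
  F = falling x
  expand : ∀ s f′ l f → s * (f′ + l * f) ≡ l * s * f + s * f′
  expand = solve-∀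
  multiply : ∀ l → x * (S q l * F l) ≡ l * S q l * F l + S q l * F (suc l)
  multiply l = trans (*-leftComm x (S q l) (F l))
                     (trans (cong (S q l *_) (falling-suc x l)) (expand (S q l) (F (suc l)) l (F l)))

^≡Σ₁-fact*S*C : ∀ x q → 1 ≤ q → x ^ q ≡ Σ₁ q (λ l → fact l * S q l * (x C l))
^≡Σ₁-fact*S*C x (suc q) _ =
  trans (^≡∑-S*falling x (suc q))
  (trans (∑-upTo-suc (suc q) (λ l → S (suc q) l * falling x l))
         (∑-cong (upTo (suc q)) (λ l → reorder (S (suc q) (suc l)) (fact (suc l)) (x C suc l))))
  where
  reorder : ∀ s f c → s * (f * c) ≡ f * s * c
  reorder = solve-∀

infix 8 _⊆ᵇ_

_⊆ᵇ_ : ∀ {m} → Subset m → (Fin m → Bool) → Bool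
_⊆ᵇ_ {m} B X = all (λ v → not (lookup B v) ∨ X v) (allFin m)

⊆ᵇ-∷ : ∀ {m} b (B : Subset m) X → (b ∷ B) ⊆ᵇ X ≡ (not b ∨ X zero) ∧ B ⊆ᵇ (X ∘ suc)
⊆ᵇ-∷ {m} b B X = all-allFin-suc m (λ v → not (lookup (b ∷ B) v) ∨ X v)

⊆ᵇ-all : ∀ {I : Set} {m} (xs : List I) (B : Subset m) (R : I → Fin m → Bool) →
  B ⊆ᵇ (λ v → all (λ i → R i v) xs) ≡ all (λ i → B ⊆ᵇ R i) xs
⊆ᵇ-all {m = m} xs B R =
  trans (all-cong (allFin m) (λ v → ∨-all xs (not (lookup B v)) (λ i → R i v)))
        (all-comm (allFin m) xs (λ v i → not (lookup B v) ∨ R i v))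

⊆ᵇ⁻ : ∀ {m} (A : Subset m) {X v} → A ⊆ᵇ X ≡ true → lookup A v ≡ true → X v ≡ true
⊆ᵇ⁻ A {X} {v} h v∈A = subst (λ b → (not b ∨ X v) ≡ true) v∈A (all⁻ h (∈-allFin v))

⊆ᵇ⁺ : ∀ {m} (A : Subset m) {X} → (∀ v → lookup A v ≡ true → X v ≡ true) → A ⊆ᵇ X ≡ true
⊆ᵇ⁺ {m} A h = all⁺ (allFin m) (λ {v} _ → implication (h v))
  where
  implication : ∀ {a b} → (a ≡ true → b ≡ true) → (not a ∨ b) ≡ true
  implication {true}  f = f refl
  implication {false} f = refl

⊆ᵇ-const : ∀ {m} (A : Subset m) {X c a} → (∀ v → lookup A v ≡ true → X v ≡ c) → lookup A a ≡ true →
  A ⊆ᵇ X ≡ c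
⊆ᵇ-const A {X} {true}      h a∈A = ⊆ᵇ⁺ A h
⊆ᵇ-const A {X} {false} {a} h a∈A with A ⊆ᵇ X in e
... | true  with () ← trans (sym (h a a∈A)) (⊆ᵇ⁻ A e a∈A)
... | false = refl

pairwise≡⊆ᵇ : ∀ {m} (A B : Subset m) (R : Fin m → Fin m → Bool) →
  all (λ u → all (λ v → not (lookup A u ∧ lookup B v) ∨ R u v) (allFin m)) (allFin m) ≡ A ⊆ᵇ (λ u → B ⊆ᵇ R u)
pairwise≡⊆ᵇ {m} A B R = all-cong (allFin m) (λ u →
  trans (all-cong (allFin m) (λ v → curry (lookup A u) (lookup B v) (R u v)))
        (sym (∨-all (allFin m) (not (lookup A u)) (λ v → not (lookup B v) ∨ R u v))))
  where
  curry : ∀ a b c → (not (a ∧ b) ∨ c) ≡ (not a ∨ (not b ∨ c))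
  curry true  b c = refl
  curry false b c = refl

∣∣≡ᵇsuc⇒nonempty : ∀ {m k} (A : Subset m) → (∣ A ∣ ≡ᵇ suc k) ≡ true → ∃[ a ] lookup A a ≡ true
∣∣≡ᵇsuc⇒nonempty (true  ∷ A) _ = zero , refl
∣∣≡ᵇsuc⇒nonempty (false ∷ A) e with ∣∣≡ᵇsuc⇒nonempty A e
... | a , a∈A = suc a , a∈A

∑-allSubsets-suc : ∀ m (F : Subset (suc m) → ℕ) →
  ∑ (allSubsets (suc m)) F ≡ ∑[ B ∈ allSubsets m ] F (false ∷ B) + ∑[ B ∈ allSubsets m ] F (true ∷ B)
∑-allSubsets-suc m F =
  trans (∑-concatMap (allSubsets m) _ F)
  (trans (∑-cong (allSubsets m) (λ B → cong (F (false ∷ B) +_) (+-identityʳ (F (true ∷ B)))))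
         (∑-+ (allSubsets m) (λ B → F (false ∷ B)) (λ B → F (true ∷ B))))

count-allFin-suc : ∀ {m} (X : Fin (suc m) → Bool) →
  count X (allFin (suc m)) ≡ ⟦ X zero ⟧ + count (X ∘ suc) (allFin m)
count-allFin-suc {m} X =
  trans (count≡∑ X (allFin (suc m)))
  (trans (∑-allFin-suc m (λ v → ⟦ X v ⟧)) (cong (⟦ X zero ⟧ +_) (sym (count≡∑ (X ∘ suc) (allFin m)))))

#subsets : ∀ {m} → (Fin m → Bool) → ℕ → ℕ
#subsets {m} X l = ∑[ B ∈ allSubsets m ] ⟦ (∣ B ∣ ≡ᵇ l) ∧ B ⊆ᵇ X ⟧

#subsets-suc : ∀ {m} (X : Fin (suc m) → Bool) l →
  #subsets X l ≡ #subsets (X ∘ suc) l + ∑[ B ∈ allSubsets m ] ⟦ (suc ∣ B ∣ ≡ᵇ l) ∧ X zero ∧ B ⊆ᵇ (X ∘ suc) ⟧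
#subsets-suc {m} X l =
  trans (∑-allSubsets-suc m (λ B → ⟦ (∣ B ∣ ≡ᵇ l) ∧ B ⊆ᵇ X ⟧))
        (cong₂ _+_ (∑-cong (allSubsets m) (λ B → cong (λ b → ⟦ (∣ B ∣ ≡ᵇ l) ∧ b ⟧) (⊆ᵇ-∷ false B X)))
                   (∑-cong (allSubsets m) (λ B → cong (λ b → ⟦ (suc ∣ B ∣ ≡ᵇ l) ∧ b ⟧) (⊆ᵇ-∷ true B X))))

C-pascal-⟦⟧ : ∀ b c l → c C suc l + ⟦ b ⟧ * (c C l) ≡ (⟦ b ⟧ + c) C suc l
C-pascal-⟦⟧ false c l = +-identityʳ (c C suc l)
C-pascal-⟦⟧ true  c l =
  trans (cong (c C suc l +_) (*-identityˡ (c C l)))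
        (trans (+-comm (c C suc l) (c C l)) (nCk+nC[k+1]≡[n+1]C[k+1] c l))

#subsets≡C : ∀ m (X : Fin m → Bool) l → #subsets X l ≡ count X (allFin m) C l
#subsets≡C zero    X zero    = refl
#subsets≡C zero    X (suc l) = refl
#subsets≡C (suc m) X zero    =
  trans (#subsets-suc X zero) (cong₂ _+_ (#subsets≡C m (X ∘ suc) zero) (∑-zero (allSubsets m)))
#subsets≡C (suc m) X (suc l) = begin
  #subsets X (suc l)
    ≡⟨ #subsets-suc X (suc l) ⟩
  #subsets X′ (suc l) + ∑[ B ∈ allSubsets m ] ⟦ (∣ B ∣ ≡ᵇ l) ∧ X zero ∧ B ⊆ᵇ X′ ⟧
    ≡⟨ cong (#subsets X′ (suc l) +_) (∑-cong (allSubsets m) (λ B →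
         ⟦a∧b∧c⟧≡⟦b⟧*⟦a∧c⟧ (∣ B ∣ ≡ᵇ l) (X zero) (B ⊆ᵇ X′))) ⟩
  #subsets X′ (suc l) + ∑[ B ∈ allSubsets m ] ⟦ X zero ⟧ * ⟦ (∣ B ∣ ≡ᵇ l) ∧ B ⊆ᵇ X′ ⟧
    ≡⟨ cong (#subsets X′ (suc l) +_) (∑-*ˡ (allSubsets m) ⟦ X zero ⟧ (λ B → ⟦ (∣ B ∣ ≡ᵇ l) ∧ B ⊆ᵇ X′ ⟧)) ⟩
  #subsets X′ (suc l) + ⟦ X zero ⟧ * #subsets X′ l
    ≡⟨ cong₂ (λ u v → u + ⟦ X zero ⟧ * v) (#subsets≡C m X′ (suc l)) (#subsets≡C m X′ l) ⟩
  count X′ (allFin m) C suc l + ⟦ X zero ⟧ * (count X′ (allFin m) C l)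
    ≡⟨ C-pascal-⟦⟧ (X zero) (count X′ (allFin m)) l ⟩
  (⟦ X zero ⟧ + count X′ (allFin m)) C suc l
    ≡⟨ cong (_C suc l) (count-allFin-suc X) ⟨
  count X (allFin (suc m)) C suc l
    ∎
  where
  open ≡-Reasoning
  X′ : Fin m → Bool
  X′ = X ∘ suc

-- allFuns builds its functions with a local cons that agrees with _∷ᶠ_ only pointwise,
-- hence the invariance hypothesis on W (also in ∑-allFuns-+).
∑-allFuns-suc : ∀ q m (W : (Fin (suc q) → Fin m) → ℕ) → W Preserves _≗_ ⟶ _≡_ →
  ∑ (allFuns (suc q) m) W ≡ ∑[ f ∈ allFuns q m ] ∑[ x ∈ allFin m ] W (x ∷ᶠ f)
∑-allFuns-suc q m W W-resp =
  trans (∑-concatMap (allFuns q m) _ W)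
        (∑-cong (allFuns q m) (λ f → trans (∑-map (allFin m) _ W)
          (∑-cong (allFin m) (λ x → W-resp (λ { zero → refl ; (suc i) → refl })))))

∑-allFuns-+ : ∀ p q m (W : (Fin p → Fin m) → (Fin q → Fin m) → ℕ) → W Preserves₂ _≗_ ⟶ _≗_ ⟶ _≡_ →
  ∑[ φ ∈ allFuns (p + q) m ] W (take p φ) (drop p φ) ≡ ∑[ f ∈ allFuns p m ] ∑[ g ∈ allFuns q m ] W f g
∑-allFuns-+ zero q m W W-resp =
  trans (∑-cong (allFuns q m) (λ φ → W-resp (λ ()) (λ _ → refl))) (sym (+-identityʳ _))
∑-allFuns-+ (suc p) q m W W-resp = begin
  ∑[ φ ∈ allFuns (suc (p + q)) m ] W (take (suc p) φ) (drop (suc p) φ)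
    ≡⟨ ∑-allFuns-suc (p + q) m _ (λ e → W-resp (e ∘ (_↑ˡ q)) (e ∘ (suc p ↑ʳ_))) ⟩
  ∑[ φ ∈ allFuns (p + q) m ] ∑[ x ∈ allFin m ] W (take (suc p) (x ∷ᶠ φ)) (drop p φ)
    ≡⟨ ∑-cong (allFuns (p + q) m) (λ φ → ∑-cong (allFin m) (λ x →
         W-resp (λ { zero → refl ; (suc i) → refl }) (λ _ → refl))) ⟩
  ∑[ φ ∈ allFuns (p + q) m ] W′ (take p φ) (drop p φ)
    ≡⟨ ∑-allFuns-+ p q m W′ (λ e e′ → ∑-cong (allFin m) (λ x →
         W-resp (λ { zero → refl ; (suc i) → e i }) e′)) ⟩
  ∑[ f ∈ allFuns p m ] ∑[ g ∈ allFuns q m ] W′ f g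
    ≡⟨ ∑-cong (allFuns p m) (λ f → ∑-comm (allFuns q m) (allFin m) (λ g x → W (x ∷ᶠ f) g)) ⟩
  ∑[ f ∈ allFuns p m ] ∑[ x ∈ allFin m ] ∑[ g ∈ allFuns q m ] W (x ∷ᶠ f) g
    ≡⟨ ∑-allFuns-suc p m _ (λ e → ∑-cong (allFuns q m) (λ g → W-resp e (λ _ → refl))) ⟨
  ∑[ f ∈ allFuns (suc p) m ] ∑[ g ∈ allFuns q m ] W f g
    ∎
  where
  open ≡-Reasoning
  W′ : (Fin p → Fin m) → (Fin q → Fin m) → ℕ
  W′ f g = ∑[ x ∈ allFin m ] W (x ∷ᶠ f) g

∑-allFuns-all≡count^ : ∀ {m} q (P : Fin m → Bool) →
  ∑[ g ∈ allFuns q m ] ⟦ all (λ j → P (g j)) (allFin q) ⟧ ≡ count P (allFin m) ^ q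
∑-allFuns-all≡count^         zero    P = refl
∑-allFuns-all≡count^ {m = m} (suc q) P = begin
  ∑[ g ∈ allFuns (suc q) m ] ⟦ all (λ j → P (g j)) (allFin (suc q)) ⟧
    ≡⟨ ∑-allFuns-suc q m _ (λ e → cong ⟦_⟧ (all-cong (allFin (suc q)) (λ j → cong P (e j)))) ⟩
  ∑[ f ∈ allFuns q m ] ∑[ x ∈ allFin m ] ⟦ all (λ j → P ((x ∷ᶠ f) j)) (allFin (suc q)) ⟧
    ≡⟨ ∑-cong (allFuns q m) (λ f → ∑-cong (allFin m) (λ x →
         trans (cong ⟦_⟧ (all-allFin-suc q _)) (⟦∧⟧ (P x) (all (λ j → P (f j)) (allFin q))))) ⟩
  ∑[ f ∈ allFuns q m ] ∑[ x ∈ allFin m ] ⟦ P x ⟧ * ⟦ all (λ j → P (f j)) (allFin q) ⟧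
    ≡⟨ ∑-cong (allFuns q m) (λ f → trans (∑-*ʳ (allFin m) _ (λ x → ⟦ P x ⟧))
                                          (cong (_* _) (sym (count≡∑ P (allFin m))))) ⟩
  ∑[ f ∈ allFuns q m ] count P (allFin m) * ⟦ all (λ j → P (f j)) (allFin q) ⟧
    ≡⟨ ∑-*ˡ (allFuns q m) (count P (allFin m)) (λ f → ⟦ all (λ j → P (f j)) (allFin q) ⟧) ⟩
  count P (allFin m) * (∑[ f ∈ allFuns q m ] ⟦ all (λ j → P (f j)) (allFin q) ⟧)
    ≡⟨ cong (count P (allFin m) *_) (∑-allFuns-all≡count^ q P) ⟩
  count P (allFin m) * count P (allFin m) ^ q
    ∎
  where open ≡-Reasoning

∑-allFuns-all≡Σ₁-#subsets : ∀ {m q} → 1 ≤ q → (P : Fin m → Bool) →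
  ∑[ g ∈ allFuns q m ] ⟦ all (λ j → P (g j)) (allFin q) ⟧ ≡ Σ₁ q (λ l → fact l * S q l * #subsets P l)
∑-allFuns-all≡Σ₁-#subsets {m} {q} 1≤q P =
  trans (∑-allFuns-all≡count^ q P)
  (trans (^≡Σ₁-fact*S*C (count P (allFin m)) q 1≤q)
         (∑-cong (upTo q) (λ l → cong (fact (suc l) * S q (suc l) *_) (sym (#subsets≡C m P (suc l))))))

-- Bicliques of a relation

allRelatedᵇ : ∀ {m p q} → (Fin m → Fin m → Bool) → (Fin p → Fin m) → (Fin q → Fin m) → Bool
allRelatedᵇ {p = p} {q} R f g = all (λ i → all (λ j → R (f i) (g j)) (allFin q)) (allFin p)

#bicliques : ∀ {m} → (Fin m → Fin m → Bool) → ℕ → ℕ → ℕ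
#bicliques {m} R k l =
  ∑[ A ∈ allSubsets m ] ∑[ B ∈ allSubsets m ] ⟦ (∣ A ∣ ≡ᵇ k) ∧ (∣ B ∣ ≡ᵇ l) ∧ A ⊆ᵇ (λ u → B ⊆ᵇ R u) ⟧

∑-#subsets≡#bicliques : ∀ {m} (R : Fin m → Fin m → Bool) k l →
  ∑[ B ∈ allSubsets m ] ⟦ ∣ B ∣ ≡ᵇ l ⟧ * #subsets (λ u → B ⊆ᵇ R u) k ≡ #bicliques R k l
∑-#subsets≡#bicliques {m} R k l =
  trans (∑-cong (allSubsets m) (λ B → sym (∑-*ˡ (allSubsets m) ⟦ ∣ B ∣ ≡ᵇ l ⟧ _)))
  (trans (∑-cong (allSubsets m) (λ B → ∑-cong (allSubsets m) (λ A →
            sym (⟦a∧b∧c⟧≡⟦b⟧*⟦a∧c⟧ (∣ A ∣ ≡ᵇ k) (∣ B ∣ ≡ᵇ l) (A ⊆ᵇ (λ u → B ⊆ᵇ R u))))))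
         (∑-comm (allSubsets m) (allSubsets m) _))

∑-allFuns-#subsets≡Σ₁-#bicliques : ∀ {m p} → 1 ≤ p → (R : Fin m → Fin m → Bool) → ∀ l →
  ∑[ f ∈ allFuns p m ] #subsets (λ v → all (λ i → R (f i) v) (allFin p)) l
    ≡ Σ₁ p (λ k → fact k * S p k * #bicliques R k l)
∑-allFuns-#subsets≡Σ₁-#bicliques {m} {p} 1≤p R l = begin
  ∑[ f ∈ allFuns p m ] ∑[ B ∈ allSubsets m ] ⟦ (∣ B ∣ ≡ᵇ l) ∧ B ⊆ᵇ (λ v → all (λ i → R (f i) v) (allFin p)) ⟧
    ≡⟨ ∑-comm (allFuns p m) (allSubsets m) _ ⟩
  ∑[ B ∈ allSubsets m ] ∑[ f ∈ allFuns p m ] ⟦ (∣ B ∣ ≡ᵇ l) ∧ B ⊆ᵇ (λ v → all (λ i → R (f i) v) (allFin p)) ⟧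
    ≡⟨ ∑-cong (allSubsets m) (λ B → ∑-cong (allFuns p m) (λ f →
         trans (cong (λ b → ⟦ (∣ B ∣ ≡ᵇ l) ∧ b ⟧) (⊆ᵇ-all (allFin p) B (λ i → R (f i))))
               (⟦∧⟧ (∣ B ∣ ≡ᵇ l) _))) ⟩
  ∑[ B ∈ allSubsets m ] ∑[ f ∈ allFuns p m ] ⟦ ∣ B ∣ ≡ᵇ l ⟧ * ⟦ all (λ i → D B (f i)) (allFin p) ⟧
    ≡⟨ ∑-cong (allSubsets m) (λ B → ∑-*ˡ (allFuns p m) ⟦ ∣ B ∣ ≡ᵇ l ⟧ _) ⟩
  ∑[ B ∈ allSubsets m ] ⟦ ∣ B ∣ ≡ᵇ l ⟧ * (∑[ f ∈ allFuns p m ] ⟦ all (λ i → D B (f i)) (allFin p) ⟧)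
    ≡⟨ ∑-cong (allSubsets m) (λ B → cong (⟦ ∣ B ∣ ≡ᵇ l ⟧ *_) (∑-allFuns-all≡Σ₁-#subsets 1≤p (D B))) ⟩
  ∑[ B ∈ allSubsets m ] ⟦ ∣ B ∣ ≡ᵇ l ⟧ * Σ₁ p (λ k → c k * #subsets (D B) k)
    ≡⟨ ∑-cong (allSubsets m) (λ B → trans (sym (∑-*ˡ (upTo p) ⟦ ∣ B ∣ ≡ᵇ l ⟧ _))
         (∑-cong (upTo p) (λ k → *-leftComm ⟦ ∣ B ∣ ≡ᵇ l ⟧ (c (suc k)) _))) ⟩
  ∑[ B ∈ allSubsets m ] Σ₁ p (λ k → c k * (⟦ ∣ B ∣ ≡ᵇ l ⟧ * #subsets (D B) k))
    ≡⟨ ∑-comm-*ˡ (allSubsets m) (upTo p) (c ∘ suc) (λ B k → ⟦ ∣ B ∣ ≡ᵇ l ⟧ * #subsets (D B) (suc k)) ⟩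
  Σ₁ p (λ k → c k * (∑[ B ∈ allSubsets m ] ⟦ ∣ B ∣ ≡ᵇ l ⟧ * #subsets (D B) k))
    ≡⟨ ∑-cong (upTo p) (λ k → cong (c (suc k) *_) (∑-#subsets≡#bicliques R (suc k) l)) ⟩
  Σ₁ p (λ k → c k * #bicliques R k l)
    ∎
  where
  open ≡-Reasoning
  D : Subset m → Fin m → Bool
  D B u = B ⊆ᵇ R u
  c : ℕ → ℕ
  c k = fact k * S p k

∑∑-allRelated≡Σ₁Σ₁-#bicliques : ∀ {m p q} → 1 ≤ p → 1 ≤ q → (R : Fin m → Fin m → Bool) →
  ∑[ f ∈ allFuns p m ] ∑[ g ∈ allFuns q m ] ⟦ allRelatedᵇ R f g ⟧
    ≡ Σ₁ p (λ k → Σ₁ q (λ l → fact k * fact l * S p k * S q l * #bicliques R k l))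
∑∑-allRelated≡Σ₁Σ₁-#bicliques {m} {p} {q} 1≤p 1≤q R = begin
  ∑[ f ∈ allFuns p m ] ∑[ g ∈ allFuns q m ] ⟦ allRelatedᵇ R f g ⟧
    ≡⟨ ∑-cong (allFuns p m) (λ f →
         trans (∑-cong (allFuns q m) (λ g →
                  cong ⟦_⟧ (all-comm (allFin p) (allFin q) (λ i j → R (f i) (g j)))))
               (∑-allFuns-all≡Σ₁-#subsets 1≤q (λ v → all (λ i → R (f i) v) (allFin p)))) ⟩
  ∑[ f ∈ allFuns p m ] Σ₁ q (λ l → c q l * #subsets (λ v → all (λ i → R (f i) v) (allFin p)) l)
    ≡⟨ ∑-comm-*ˡ (allFuns p m) (upTo q) (c q ∘ suc) _ ⟩
  Σ₁ q (λ l → c q l * (∑[ f ∈ allFuns p m ] #subsets (λ v → all (λ i → R (f i) v) (allFin p)) l))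
    ≡⟨ ∑-cong (upTo q) (λ l → cong (c q (suc l) *_) (∑-allFuns-#subsets≡Σ₁-#bicliques 1≤p R (suc l))) ⟩
  Σ₁ q (λ l → c q l * Σ₁ p (λ k → c p k * #bicliques R k l))
    ≡⟨ ∑-cong (upTo q) (λ l → sym (∑-*ˡ (upTo p) (c q (suc l)) _)) ⟩
  Σ₁ q (λ l → Σ₁ p (λ k → c q l * (c p k * #bicliques R k l)))
    ≡⟨ ∑-comm (upTo q) (upTo p) _ ⟩
  Σ₁ p (λ k → Σ₁ q (λ l → c q l * (c p k * #bicliques R k l)))
    ≡⟨ ∑-cong (upTo p) (λ k → ∑-cong (upTo q) (λ l →
         reorder (fact (suc k)) (fact (suc l)) (S p (suc k)) (S q (suc l)) (#bicliques R (suc k) (suc l)))) ⟩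
  Σ₁ p (λ k → Σ₁ q (λ l → fact k * fact l * S p k * S q l * #bicliques R k l))
    ∎
  where
  open ≡-Reasoning
  c : ℕ → ℕ → ℕ
  c r k = fact k * S r k
  reorder : ∀ a b s t x → b * t * (a * s * x) ≡ a * b * s * t * x
  reorder = solve-∀

toℕ-↑ˡ-<ᵇ : ∀ p q (i : Fin p) → (toℕ (i ↑ˡ q) <ᵇ p) ≡ true
toℕ-↑ˡ-<ᵇ (suc p) q zero    = refl
toℕ-↑ˡ-<ᵇ (suc p) q (suc i) = toℕ-↑ˡ-<ᵇ p q i

toℕ-↑ʳ-<ᵇ : ∀ p q (j : Fin q) → (toℕ (p ↑ʳ j) <ᵇ p) ≡ false
toℕ-↑ʳ-<ᵇ zero    q j = refl
toℕ-↑ʳ-<ᵇ (suc p) q j = toℕ-↑ʳ-<ᵇ p q j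

isHom-K : ∀ G p q (φ : Fin (p + q) → Fin (n G)) →
  isHom (K p q) G φ ≡ allRelatedᵇ (adj G) (take p φ) (drop p φ)
isHom-K G p q φ = begin
  all (λ u → all (edge u) (allFin (p + q))) (allFin (p + q))
    ≡⟨ all-allFin-+ p q _ ⟩
  all (λ i → all (edge (i ↑ˡ q)) (allFin (p + q))) (allFin p) ∧
  all (λ j → all (edge (p ↑ʳ j)) (allFin (p + q))) (allFin q)
    ≡⟨ cong₂ _∧_ (all-cong (allFin p) (λ i → trans (all-allFin-+ p q _)
                   (cong₂ _∧_ (all⁺ (allFin p) (λ {i′} _ → edge-LL i i′)) (all-cong (allFin q) (edge-LR i)))))
                 (all-cong (allFin q) (λ j → trans (all-allFin-+ p q _)
                   (cong₂ _∧_ (all-cong (allFin p) (λ i → edge-RL i j))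
                              (all⁺ (allFin q) (λ {j′} _ → edge-RR j j′))))) ⟩
  all (λ i → true ∧ all (λ j → adj G (f i) (g j)) (allFin q)) (allFin p) ∧
  all (λ j → all (λ i → adj G (f i) (g j)) (allFin p) ∧ true) (allFin q)
    ≡⟨ cong (allRelatedᵇ (adj G) f g ∧_) (all-cong (allFin q) (λ j → ∧-identityʳ _)) ⟩
  allRelatedᵇ (adj G) f g ∧ all (λ j → all (λ i → adj G (f i) (g j)) (allFin p)) (allFin q)
    ≡⟨ cong (allRelatedᵇ (adj G) f g ∧_) (all-comm (allFin p) (allFin q) (λ i j → adj G (f i) (g j))) ⟨
  allRelatedᵇ (adj G) f g ∧ allRelatedᵇ (adj G) f g
    ≡⟨ ∧-idem _ ⟩
  allRelatedᵇ (adj G) f g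
    ∎
  where
  open ≡-Reasoning
  f : Fin p → Fin (n G)
  f = take p φ
  g : Fin q → Fin (n G)
  g = drop p φ
  edge : Fin (p + q) → Fin (p + q) → Bool
  edge u v = not ((toℕ u <ᵇ p) xor (toℕ v <ᵇ p)) ∨ adj G (φ u) (φ v)
  edge-LL : ∀ i i′ → edge (i ↑ˡ q) (i′ ↑ˡ q) ≡ true
  edge-LL i i′ rewrite toℕ-↑ˡ-<ᵇ p q i | toℕ-↑ˡ-<ᵇ p q i′ = refl
  edge-LR : ∀ i j → edge (i ↑ˡ q) (p ↑ʳ j) ≡ adj G (f i) (g j)
  edge-LR i j rewrite toℕ-↑ˡ-<ᵇ p q i | toℕ-↑ʳ-<ᵇ p q j = refl
  edge-RL : ∀ i j → edge (p ↑ʳ j) (i ↑ˡ q) ≡ adj G (f i) (g j)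
  edge-RL i j rewrite toℕ-↑ˡ-<ᵇ p q i | toℕ-↑ʳ-<ᵇ p q j = Graph.sym G (g j) (f i)
  edge-RR : ∀ j j′ → edge (p ↑ʳ j) (p ↑ʳ j′) ≡ true
  edge-RR j j′ rewrite toℕ-↑ʳ-<ᵇ p q j | toℕ-↑ʳ-<ᵇ p q j′ = refl

hom-K≡∑∑-allRelated : ∀ G p q →
  hom (K p q) G ≡ ∑[ f ∈ allFuns p (n G) ] ∑[ g ∈ allFuns q (n G) ] ⟦ allRelatedᵇ (adj G) f g ⟧
hom-K≡∑∑-allRelated G p q =
  trans (count≡∑ (isHom (K p q) G) (allFuns (p + q) (n G)))
  (trans (∑-cong (allFuns (p + q) (n G)) (λ φ → cong ⟦_⟧ (isHom-K G p q φ)))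
         (∑-allFuns-+ p q (n G) (λ f g → ⟦ allRelatedᵇ (adj G) f g ⟧)
            (λ e e′ → cong ⟦_⟧ (all-cong (allFin p) (λ i →
                        all-cong (allFin q) (λ j → cong₂ (adj G) (e i) (e′ j)))))))

-- Bipartite graphs

⊆ᵇ-adj-comm : ∀ G (A B : Subset (n G)) → B ⊆ᵇ (λ v → A ⊆ᵇ adj G v) ≡ A ⊆ᵇ (λ u → B ⊆ᵇ adj G u)
⊆ᵇ-adj-comm G A B = begin
  B ⊆ᵇ (λ v → A ⊆ᵇ adj G v)
    ≡⟨ pairwise≡⊆ᵇ B A (adj G) ⟨
  all (λ v → all (λ u → not (lookup B v ∧ lookup A u) ∨ adj G v u) (allFin (n G))) (allFin (n G))
    ≡⟨ all-comm (allFin (n G)) (allFin (n G)) _ ⟩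
  all (λ u → all (λ v → not (lookup B v ∧ lookup A u) ∨ adj G v u) (allFin (n G))) (allFin (n G))
    ≡⟨ all-cong (allFin (n G)) (λ u → all-cong (allFin (n G)) (λ v →
         cong₂ (λ x y → not x ∨ y) (∧-comm (lookup B v) (lookup A u)) (Graph.sym G v u))) ⟩
  all (λ u → all (λ v → not (lookup A u ∧ lookup B v) ∨ adj G u v) (allFin (n G))) (allFin (n G))
    ≡⟨ pairwise≡⊆ᵇ A B (adj G) ⟩
  A ⊆ᵇ (λ u → B ⊆ᵇ adj G u)
    ∎
  where open ≡-Reasoning

indicator-split : ∀ a b c x₁ x₂ y₁ y₂ → (a ≡ true → b ≡ true → c ≡ true → (x₁ ∧ x₂) ≡ not (y₁ ∧ y₂)) →
  ⟦ a ∧ b ∧ c ⟧ ≡ ⟦ a ∧ b ∧ x₁ ∧ x₂ ∧ c ⟧ + ⟦ b ∧ a ∧ y₁ ∧ y₂ ∧ c ⟧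
indicator-split false false c     x₁ x₂ y₁ y₂ h = refl
indicator-split false true  c     x₁ x₂ y₁ y₂ h = refl
indicator-split true  false c     x₁ x₂ y₁ y₂ h = refl
indicator-split true  true  false x₁ x₂ y₁ y₂ h
  rewrite ∧-zeroʳ x₂ | ∧-zeroʳ x₁ | ∧-zeroʳ y₂ | ∧-zeroʳ y₁ = refl
indicator-split true  true  true  x₁ x₂ y₁ y₂ h
  rewrite ∧-identityʳ x₂ | ∧-identityʳ y₂ | h refl refl refl = one (y₁ ∧ y₂)
  where
  one : ∀ y → 1 ≡ ⟦ not y ⟧ + ⟦ y ⟧
  one true  = refl
  one false = refl

module _ {G : Graph} {side : Fin (n G) → Bool} (bip : IsBipartition G side) where

  biclique-orientation : ∀ {A B : Subset (n G)} {a b} → lookup A a ≡ true → lookup B b ≡ true →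
    A ⊆ᵇ (λ u → B ⊆ᵇ adj G u) ≡ true →
    (A ⊆ᵇ (not ∘ side) ∧ B ⊆ᵇ side) ≡ not (B ⊆ᵇ (not ∘ side) ∧ A ⊆ᵇ side)
  biclique-orientation {A} {B} {a} {b} a∈A b∈B complete =
    trans (cong₂ _∧_ A⊆L B⊆R) (trans (exclusive (side a)) (cong not (sym (cong₂ _∧_ B⊆L A⊆R))))
    where
    adjacent : ∀ {u v} → lookup A u ≡ true → lookup B v ≡ true → adj G u v ≡ true
    adjacent u∈A v∈B = ⊆ᵇ⁻ B (⊆ᵇ⁻ A complete u∈A) v∈B
    B-side : ∀ v → lookup B v ≡ true → side v ≡ not (side a)
    B-side v v∈B = trans (sym (not-involutive (side v))) (cong not (sym (bip a v (adjacent a∈A v∈B))))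
    A-side : ∀ u → lookup A u ≡ true → side u ≡ side a
    A-side u u∈A =
      trans (bip u b (adjacent u∈A b∈B)) (trans (cong not (B-side b b∈B)) (not-involutive (side a)))
    A⊆L : A ⊆ᵇ (not ∘ side) ≡ not (side a)
    A⊆L = ⊆ᵇ-const A (λ u u∈A → cong not (A-side u u∈A)) a∈A
    B⊆R : B ⊆ᵇ side ≡ not (side a)
    B⊆R = ⊆ᵇ-const B B-side b∈B
    B⊆L : B ⊆ᵇ (not ∘ side) ≡ side a
    B⊆L = ⊆ᵇ-const B (λ v v∈B → trans (cong not (B-side v v∈B)) (not-involutive (side a))) b∈B
    A⊆R : A ⊆ᵇ side ≡ side a
    A⊆R = ⊆ᵇ-const A A-side a∈A
    exclusive : ∀ s → (not s ∧ not s) ≡ not (s ∧ s)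
    exclusive true  = refl
    exclusive false = refl

  N≡∑∑ : ∀ k l → N G side k l ≡
    ∑[ A ∈ allSubsets (n G) ] ∑[ B ∈ allSubsets (n G) ]
      ⟦ (∣ A ∣ ≡ᵇ k) ∧ (∣ B ∣ ≡ᵇ l) ∧ A ⊆ᵇ (not ∘ side) ∧ B ⊆ᵇ side ∧ A ⊆ᵇ (λ u → B ⊆ᵇ adj G u) ⟧
  N≡∑∑ k l =
    trans (count≡∑ _ (cartesianProduct (allSubsets (n G)) (allSubsets (n G))))
    (trans (∑-cartesianProduct (allSubsets (n G)) (allSubsets (n G)) _)
           (∑-cong (allSubsets (n G)) (λ A → ∑-cong (allSubsets (n G)) (λ B →
              cong (λ c → ⟦ (∣ A ∣ ≡ᵇ k) ∧ (∣ B ∣ ≡ᵇ l) ∧ A ⊆ᵇ (not ∘ side) ∧ B ⊆ᵇ side ∧ c ⟧)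
                   (pairwise≡⊆ᵇ A B (adj G))))))

  #bicliques≡N+N : ∀ k l →
    #bicliques (adj G) (suc k) (suc l) ≡ N G side (suc k) (suc l) + N G side (suc l) (suc k)
  #bicliques≡N+N k l = begin
    #bicliques (adj G) (suc k) (suc l)
      ≡⟨ ∑-cong SS (λ A → ∑-cong SS (λ B → split A B)) ⟩
    ∑[ A ∈ SS ] ∑[ B ∈ SS ] (⟦ L×R A B ⟧ + ⟦ R×L A B ⟧)
      ≡⟨ trans (∑-cong SS (λ A → ∑-+ SS (λ B → ⟦ L×R A B ⟧) (λ B → ⟦ R×L A B ⟧)))
               (∑-+ SS (λ A → ∑[ B ∈ SS ] ⟦ L×R A B ⟧) (λ A → ∑[ B ∈ SS ] ⟦ R×L A B ⟧)) ⟩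
    ∑[ A ∈ SS ] ∑[ B ∈ SS ] ⟦ L×R A B ⟧ + ∑[ A ∈ SS ] ∑[ B ∈ SS ] ⟦ R×L A B ⟧
      ≡⟨ cong (_+ ∑[ A ∈ SS ] ∑[ B ∈ SS ] ⟦ R×L A B ⟧) (N≡∑∑ (suc k) (suc l)) ⟨
    N G side (suc k) (suc l) + ∑[ A ∈ SS ] ∑[ B ∈ SS ] ⟦ R×L A B ⟧
      ≡⟨ cong (N G side (suc k) (suc l) +_) (∑-comm SS SS (λ A B → ⟦ R×L A B ⟧)) ⟩
    N G side (suc k) (suc l) + ∑[ B ∈ SS ] ∑[ A ∈ SS ] ⟦ R×L A B ⟧
      ≡⟨ cong (N G side (suc k) (suc l) +_) (trans (∑-cong SS (λ B → ∑-cong SS (λ A →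
           cong (λ c → ⟦ (∣ B ∣ ≡ᵇ suc l) ∧ (∣ A ∣ ≡ᵇ suc k) ∧ B ⊆ᵇ (not ∘ side) ∧ A ⊆ᵇ side ∧ c ⟧)
                (sym (⊆ᵇ-adj-comm G A B)))))
           (sym (N≡∑∑ (suc l) (suc k)))) ⟩
    N G side (suc k) (suc l) + N G side (suc l) (suc k)
      ∎
    where
    open ≡-Reasoning
    SS : List (Subset (n G))
    SS = allSubsets (n G)
    L×R R×L : Subset (n G) → Subset (n G) → Bool
    L×R A B = (∣ A ∣ ≡ᵇ suc k) ∧ (∣ B ∣ ≡ᵇ suc l) ∧ A ⊆ᵇ (not ∘ side) ∧ B ⊆ᵇ side ∧ A ⊆ᵇ (λ u → B ⊆ᵇ adj G u)
    R×L A B = (∣ B ∣ ≡ᵇ suc l) ∧ (∣ A ∣ ≡ᵇ suc k) ∧ B ⊆ᵇ (not ∘ side) ∧ A ⊆ᵇ side ∧ A ⊆ᵇ (λ u → B ⊆ᵇ adj G u)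
    split : ∀ A B →
      ⟦ (∣ A ∣ ≡ᵇ suc k) ∧ (∣ B ∣ ≡ᵇ suc l) ∧ A ⊆ᵇ (λ u → B ⊆ᵇ adj G u) ⟧ ≡ ⟦ L×R A B ⟧ + ⟦ R×L A B ⟧
    split A B =
      indicator-split (∣ A ∣ ≡ᵇ suc k) (∣ B ∣ ≡ᵇ suc l) (A ⊆ᵇ (λ u → B ⊆ᵇ adj G u))
                      (A ⊆ᵇ (not ∘ side)) (B ⊆ᵇ side) (B ⊆ᵇ (not ∘ side)) (A ⊆ᵇ side)
        (λ eA eB → biclique-orientation {A} {B} (proj₂ (∣∣≡ᵇsuc⇒nonempty A eA))
                                                (proj₂ (∣∣≡ᵇsuc⇒nonempty B eB)))

proposition1 : (G : Graph) (side : Fin (n G) → Bool) → IsBipartition G side →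
    (p q : ℕ) → 1 ≤ p → 1 ≤ q →
    hom (K p q) G ≡
      Σ₁ p (λ k → Σ₁ q (λ ℓ →
        fact k * fact ℓ * S p k * S q ℓ * (N G side k ℓ + N G side ℓ k)))
proposition1 G side bip p q 1≤p 1≤q = begin
  hom (K p q) G
    ≡⟨ hom-K≡∑∑-allRelated G p q ⟩
  ∑[ f ∈ allFuns p (n G) ] ∑[ g ∈ allFuns q (n G) ] ⟦ allRelatedᵇ (adj G) f g ⟧
    ≡⟨ ∑∑-allRelated≡Σ₁Σ₁-#bicliques 1≤p 1≤q (adj G) ⟩
  Σ₁ p (λ k → Σ₁ q (λ ℓ → fact k * fact ℓ * S p k * S q ℓ * #bicliques (adj G) k ℓ))
    ≡⟨ ∑-cong (upTo p) (λ k → ∑-cong (upTo q) (λ ℓ →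
         cong (fact (suc k) * fact (suc ℓ) * S p (suc k) * S q (suc ℓ) *_)
              (#bicliques≡N+N {G} {side} bip k ℓ))) ⟩
  Σ₁ p (λ k → Σ₁ q (λ ℓ → fact k * fact ℓ * S p k * S q ℓ * (N G side k ℓ + N G side ℓ k)))
    ∎
  where open ≡-Reasoning
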